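{- For every positive integer $n$, let $A_n$ be the graph described in the context. Then its Wiener index is $$W(A_n)=9+\frac{261}{10}n+29n^2+\frac{31}{2}n^3+4n^4+\frac{2}{5}n^5 .$$
   Context: All graphs are simple and connected, and $d_G(u,v)$ is the shortest-path distance in $G$. The Wiener index is $W(G)=\sum_{\{u,v\}\subseteq V(G)} d_G(u,v)$, summed over unordered pairs of distinct vertices. Benzenoid conventions. Work in the hexagonal (honeycomb) lattice, with each hexagon drawn so that it has two vertical edges. Measured from the hexagon's center, its six vertices lie at angles $30^\circ,90^\circ,150^\circ,210^\circ,270^\circ,330^\circ$. A row of $m$ hexagons consists of $m$ horizontally consecutive hexagons, each sharing a vertical edge with the next. Two consecutive rows are offset horizontally by half a hexagon, as in the honeycomb lattice. A graph built from such rows consists of all vertices and edges of the chosen hexagons, plus any pendant vertices explicitly attached. $A_n$ has $n$ rows of hexagons. Row $i$, counted from the top, has $i$ hexagons. Each hexagon of row $i$ sits on two consecutive hexagons of row $i+1$, so the hexagons form a triangle with one hexagon at the top. Three pendant vertices are added, one by a new edge to each of the following vertices: - the vertex at $90^\circ$ (the top vertex) of the top hexagon; - the vertex at $210^\circ$ (lower-left) of the leftmost hexagon of row $n$; - the vertex at $330^\circ$ (lower-right) of the rightmost hexagon of row $n$. $A_n$ has $(n+2)^2$ vertices. -}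

module Defs where

open import Data.Nat as ℕ using (ℕ; zero; suc; _≤_; _∸_)
open import Data.Integer as ℤ using (ℤ; +_)
open import Data.Product using (Σ; _×_; _,_)
open import Data.Product.Properties using (≡-dec)
open import Data.List using (List; []; _∷_; map; concatMap; _++_; deduplicate; upTo; length)
open import Data.Nat.ListAction using (sum)
open import Data.List.Membership.Propositional using (_∈_)
open import Data.Sum using (_⊎_)
open import Relation.Binary.PropositionalEquality using (_≡_)

record Graph : Set₁ where
  field
    V        : Set
    vertices : List V          -- the vertex set, listed without repetition
    Adj      : V → V → Set     -- symmetric adjacency between vertices

open Graph public

data Walk (G : Graph) : V G → V G → ℕ → Set where
  here : ∀ {u} → u ∈ vertices G → Walk G u u 0
  step : ∀ {u w v k} → Adj G u w → Walk G w v k → Walk G u v (suc k)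

IsDist : (G : Graph) → V G → V G → ℕ → Set
IsDist G u v k = Walk G u v k × (∀ m → Walk G u v m → k ≤ m)

pairSum : {A : Set} → (A → A → ℕ) → List A → ℕ
pairSum d []       = 0
pairSum d (x ∷ xs) = sum (map (d x) xs) ℕ.+ pairSum d xs

IsWienerIndex : Graph → ℕ → Set
IsWienerIndex G w =
  Σ (V G → V G → ℕ) λ d →
    (∀ u v → u ∈ vertices G → v ∈ vertices G → IsDist G u v (d u v))
    × pairSum d (vertices G) ≡ w

-- A hexagon with centre (X,Y) has vertices
--   90°: (X,Y+2)  30°: (X+1,Y+1)  330°: (X+1,Y-1)
--   270°: (X,Y-2) 210°: (X-1,Y-1) 150°: (X-1,Y+1)
-- (vertical edges have length 2 in these units).  Hexagon j (0 ≤ j ≤ i)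
-- of row i (0-based, from the top) has centre (2j - i, -3i); thus
-- consecutive hexagons of a row share a vertical edge and hexagon (i,j)
-- sits on hexagons (i+1,j) and (i+1,j+1).

Point : Set
Point = ℤ × ℤ

_+ᵖ_ : Point → Point → Point
(a , b) +ᵖ (c , d) = (a ℤ.+ c , b ℤ.+ d)

pt : ℤ → ℤ → Point
pt a b = (a , b)

-ℤ : ℕ → ℤ
-ℤ n = ℤ.- (+ n)

centre : ℕ → ℕ → Point
centre i j = ((+ (2 ℕ.* j)) ℤ.- (+ i) , -ℤ (3 ℕ.* i))

v90 v30 v330 v270 v210 v150 : Point → Point
v90  c = c +ᵖ pt (+ 0) (+ 2)
v30  c = c +ᵖ pt (+ 1) (+ 1)
v330 c = c +ᵖ pt (+ 1) (-ℤ 1)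
v270 c = c +ᵖ pt (+ 0) (-ℤ 2)
v210 c = c +ᵖ pt (-ℤ 1) (-ℤ 1)
v150 c = c +ᵖ pt (-ℤ 1) (+ 1)

hexVertices : Point → List Point
hexVertices c = v90 c ∷ v30 c ∷ v330 c ∷ v270 c ∷ v210 c ∷ v150 c ∷ []

hexEdges : Point → List (Point × Point)
hexEdges c = (v90 c , v30 c) ∷ (v30 c , v330 c) ∷ (v330 c , v270 c)
           ∷ (v270 c , v210 c) ∷ (v210 c , v150 c) ∷ (v150 c , v90 c) ∷ []

centres : ℕ → List Point
centres n = concatMap (λ i → map (centre i) (upTo (suc i))) (upTo n)

pendantEdges : ℕ → List (Point × Point)
pendantEdges n =
    (v90 top , v90 top +ᵖ pt (+ 0) (+ 2))
  ∷ (v210 left , v210 left +ᵖ pt (-ℤ 1) (-ℤ 1))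
  ∷ (v330 right , v330 right +ᵖ pt (+ 1) (-ℤ 1))
  ∷ []
  where
    top   = centre 0 0
    left  = centre (n ∸ 1) 0
    right = centre (n ∸ 1) (n ∸ 1)

edgesA : ℕ → List (Point × Point)
edgesA n = concatMap hexEdges (centres n) ++ pendantEdges n

verticesA : ℕ → List Point
verticesA n = deduplicate (≡-dec ℤ._≟_ ℤ._≟_)
  (concatMap hexVertices (centres n) ++
   map (λ e → Data.Product.proj₂ e) (pendantEdges n))

A : ℕ → Graph
A n = record
  { V        = Point
  ; vertices = verticesA n
  ; Adj      = λ u v → ((u , v) ∈ edgesA n) ⊎ ((v , u) ∈ edgesA n)
  }

module Submission where

-- Index the vertices of A_n by the lattice triples (a, b, c) with a + b + c ∈ {n, n + 1}: the
-- hexagon centres are the points of the triples of total n − 1, and the corners of the hexagon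
-- at (a, b, c) are obtained by raising one or two of its coordinates.  Every edge then joins two
-- triples at ℓ¹-distance 1, so the ℓ¹ distance bounds the graph distance from below, and it is
-- attained by greedily moving one coordinate towards the target while alternating between the
-- two layers.  Hence W(A_n) is the ℓ¹ pair sum over this slab, which by the cyclic symmetry of the
-- coordinates is three times the pair sum P of first coordinates.  Deleting the face a = 0 of a
-- slab leaves a copy of the previous slab shifted by one, which gives a recursion for P solved by
-- 30 P(k) = k (k + 1) (k + 2) (2k + 1) (2k + 3); thus 10 W(A_n) = (n + 1)(n + 2)(n + 3)(2n + 3)(2n + 5).

open import Defs
open import Data.Nat using (ℕ; _+_; _*_; _^_; _≤_)
open import Data.Product using (Σ; _×_)
open import Relation.Binary.PropositionalEquality using (_≡_)

open import Data.Nat using (zero; suc; _∸_; _<_; _<?_; z≤n; s≤s; s≤s⁻¹; ∣_-_∣)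
open import Data.Nat.Properties
open import Data.Nat.ListAction using (sum)
open import Data.Nat.ListAction.Properties using (sum-↭; sum-++)
open import Data.Nat.Tactic.RingSolver using (solve-∀; solve)
import Data.Nat.Solver
open import Algebra.Properties.CommutativeSemigroup +-commutativeSemigroup using (interchange)
open import Data.Integer as ℤ using (+_)
import Data.Integer.Properties as ℤ
import Data.Integer.Tactic.RingSolver as ℤ-Ring
open import Data.Empty using (⊥; ⊥-elim)
open import Data.Product using (_,_; proj₁; proj₂; map₁; swap) renaming (map to ×-map)
open import Data.Product.Properties using (,-injectiveʳ; ≡-dec)
open import Data.Sum using (_⊎_; inj₁; inj₂) renaming (map to ⊎-map; swap to ⊎-swap)
open import Function.Bundles using (mk⇔)
open import Data.List using (List; []; _∷_; map; _++_; length; replicate; zip; concatMap; upTo)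
open import Data.List.Properties
  using (map-∘; map-++; map-cong-local; map-replicate; length-++; length-map; length-replicate)
open import Data.List.Membership.Propositional using (_∈_)
open import Data.List.Membership.Propositional.Properties
  using (∈-map⁺; ∈-map⁻; ∈-++⁺ˡ; ∈-++⁺ʳ; ∈-++⁻; ∈-concat⁺′; ∈-concat⁻′; ∈-upTo⁺; ∈-upTo⁻;
         ∈-deduplicate⁺; ∈-deduplicate⁻)
open import Data.List.Membership.Propositional.Properties.WithK using (unique∧set⇒bag)
open import Data.List.Relation.Unary.Any using (here; there)
import Data.List.Relation.Unary.All as All
open import Data.List.Relation.Unary.AllPairs using (_∷_; [])
open import Data.List.Relation.Unary.Unique.Propositional using (Unique)
import Data.List.Relation.Unary.Unique.Propositional.Properties as Unique
open import Data.List.Relation.Unary.Unique.DecPropositional.Properties using (deduplicate-!)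
open import Data.List.Relation.Binary.Permutation.Propositional as ↭ using (_↭_)
import Data.List.Relation.Binary.Permutation.Propositional.Properties as ↭
open import Data.List.Relation.Binary.BagAndSetEquality using (∼bag⇒↭)
open import Relation.Nullary using (¬_; yes; no)
open import Relation.Binary.Definitions using (DecidableEquality)
open import Relation.Binary.PropositionalEquality
  using (_≢_; refl; sym; trans; cong; cong₂; subst; module ≡-Reasoning)

private
  variable
    X Y : Set

sum-map-+ : (f g : X → ℕ) (xs : List X) →
  sum (map (λ x → f x + g x) xs) ≡ sum (map f xs) + sum (map g xs)
sum-map-+ f g []       = refl
sum-map-+ f g (x ∷ xs) rewrite sum-map-+ f g xs = interchange (f x) (g x) _ _

pairSum-cong : (d d′ : X → X → ℕ) (xs : List X) →
  (∀ {x y} → x ∈ xs → y ∈ xs → d x y ≡ d′ x y) → pairSum d xs ≡ pairSum d′ xs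
pairSum-cong d d′ []       eq = refl
pairSum-cong d d′ (x ∷ xs) eq =
  cong₂ _+_ (cong sum (map-cong-local (All.tabulate (λ y∈ → eq (here refl) (there y∈)))))
            (pairSum-cong d d′ xs (λ p q → eq (there p) (there q)))

pairSum-map : (d : Y → Y → ℕ) (f : X → Y) (xs : List X) →
  pairSum d (map f xs) ≡ pairSum (λ x y → d (f x) (f y)) xs
pairSum-map d f []       = refl
pairSum-map d f (x ∷ xs) = cong₂ _+_ (cong sum (sym (map-∘ xs))) (pairSum-map d f xs)

pairSum-+ : (d d′ : X → X → ℕ) (xs : List X) →
  pairSum (λ x y → d x y + d′ x y) xs ≡ pairSum d xs + pairSum d′ xs
pairSum-+ d d′ []       = refl
pairSum-+ d d′ (x ∷ xs) rewrite sum-map-+ (d x) (d′ x) xs | pairSum-+ d d′ xs =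
  interchange (sum (map (d x) xs)) _ _ _

pairSum-↭ : (d : X → X → ℕ) → (∀ x y → d x y ≡ d y x) →
  ∀ {xs ys} → xs ↭ ys → pairSum d xs ≡ pairSum d ys
pairSum-↭ d d-sym ↭.refl         = refl
pairSum-↭ d d-sym (↭.prep x p)   = cong₂ _+_ (sum-↭ (↭.map⁺ (d x) p)) (pairSum-↭ d d-sym p)
pairSum-↭ d d-sym (↭.swap {ys = ys} x y p)
  rewrite pairSum-↭ d d-sym p | sum-↭ (↭.map⁺ (d x) p) | sum-↭ (↭.map⁺ (d y) p) | d-sym x y =
  interchange (d y x) (sum (map (d x) ys)) _ _
pairSum-↭ d d-sym (↭.trans p q) = trans (pairSum-↭ d d-sym p) (pairSum-↭ d d-sym q)

crossSum : (X → X → ℕ) → List X → List X → ℕ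
crossSum d xs ys = sum (map (λ x → sum (map (d x) ys)) xs)

pairSum-++ : (d : X → X → ℕ) (xs ys : List X) →
  pairSum d (xs ++ ys) ≡ pairSum d xs + pairSum d ys + crossSum d xs ys
pairSum-++ d []       ys = sym (+-identityʳ _)
pairSum-++ d (x ∷ xs) ys
  rewrite map-++ (d x) xs ys | sum-++ (map (d x) xs) (map (d x) ys) | pairSum-++ d xs ys =
  rearrange (sum (map (d x) xs)) _ _ _ _
  where
  rearrange : ∀ a b c e f → a + b + (c + e + f) ≡ a + c + e + (b + f)
  rearrange = solve-∀

∈-concatMap-intro : ∀ (f : X → List Y) {x y xs} → x ∈ xs → y ∈ f x → y ∈ concatMap f xs
∈-concatMap-intro f x∈ y∈ = ∈-concat⁺′ y∈ (∈-map⁺ f x∈)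

∈-concatMap-elim : ∀ (f : X → List Y) {y} xs → y ∈ concatMap f xs → Σ X λ x → x ∈ xs × y ∈ f x
∈-concatMap-elim f xs y∈ with ∈-concat⁻′ (map f xs) y∈
... | _ , y∈ys , ys∈ with ∈-map⁻ f ys∈
...   | x , x∈ , refl = x , x∈ , y∈ys

Unique-map-injectiveOn : ∀ (f : X → Y) {xs} → Unique xs →
  (∀ {x y} → x ∈ xs → y ∈ xs → f x ≡ f y → x ≡ y) → Unique (map f xs)
Unique-map-injectiveOn f []                inj = []
Unique-map-injectiveOn f {x ∷ xs} (x∉ ∷ u) inj =
  All.tabulate fresh ∷ Unique-map-injectiveOn f u (λ p q → inj (there p) (there q))
  where
  fresh : ∀ {z} → z ∈ map f xs → ¬ f x ≡ z
  fresh z∈ eq with ∈-map⁻ f z∈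
  ... | y , y∈ , refl = All.lookup x∉ y∈ (inj (here refl) (there y∈) eq)

module _ {Z : Set} (_≟_ : DecidableEquality Y) (f : Z → Y) (default : Z) where

  invertOn : List Z → Y → Z
  invertOn []       y = default
  invertOn (z ∷ zs) y with f z ≟ y
  ... | yes _ = z
  ... | no  _ = invertOn zs y

  invertOn-correct : ∀ {z} zs → (∀ {x y} → x ∈ zs → y ∈ zs → f x ≡ f y → x ≡ y) →
    z ∈ zs → invertOn zs (f z) ≡ z
  invertOn-correct {z} (x ∷ xs) inj z∈ with f x ≟ f z
  ... | yes eq = inj (here refl) z∈ eq
  invertOn-correct (x ∷ xs) inj (here refl) | no neq = ⊥-elim (neq refl)
  invertOn-correct (x ∷ xs) inj (there z∈) | no _ = invertOn-correct xs (λ p q → inj (there p) (there q)) z∈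

-- Lattice points of two consecutive layers of the simplex

antidiagonal : ℕ → List (ℕ × ℕ)
antidiagonal zero    = (0 , 0) ∷ []
antidiagonal (suc k) = (0 , suc k) ∷ map (map₁ suc) (antidiagonal k)

∈-antidiagonal⁻ : ∀ k {b c} → (b , c) ∈ antidiagonal k → b + c ≡ k
∈-antidiagonal⁻ zero    (here refl) = refl
∈-antidiagonal⁻ (suc k) (here refl) = refl
∈-antidiagonal⁻ (suc k) (there p) with ∈-map⁻ (map₁ suc) p
... | _ , q , refl = cong suc (∈-antidiagonal⁻ k q)

∈-antidiagonal⁺ : ∀ {k b c} → b + c ≡ k → (b , c) ∈ antidiagonal k
∈-antidiagonal⁺ {zero}  {zero}  refl = here refl
∈-antidiagonal⁺ {suc k} {zero}  refl = here refl
∈-antidiagonal⁺ {suc k} {suc b} e    = there (∈-map⁺ (map₁ suc) (∈-antidiagonal⁺ (suc-injective e)))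

length-antidiagonal : ∀ k → length (antidiagonal k) ≡ suc k
length-antidiagonal zero    = refl
length-antidiagonal (suc k) =
  cong suc (trans (length-map (map₁ suc) (antidiagonal k)) (length-antidiagonal k))

map₁-suc-injective : ∀ {p q : ℕ × X} → map₁ suc p ≡ map₁ suc q → p ≡ q
map₁-suc-injective {p = _ , _} {q = _ , _} refl = refl

antidiagonal-unique : ∀ k → Unique (antidiagonal k)
antidiagonal-unique zero    = All.[] ∷ []
antidiagonal-unique (suc k) =
  All.tabulate head-fresh ∷ Unique.map⁺ map₁-suc-injective (antidiagonal-unique k)
  where
  head-fresh : ∀ {p} → p ∈ map (map₁ suc) (antidiagonal k) → ¬ (0 , suc k) ≡ p
  head-fresh p∈ eq with ∈-map⁻ (map₁ suc) p∈
  head-fresh p∈ refl | _ , _ , ()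

Triple : Set
Triple = ℕ × ℕ × ℕ

total : Triple → ℕ
total (a , b , c) = a + b + c

total-suc₂ : ∀ a b c → total (a , suc b , c) ≡ suc (total (a , b , c))
total-suc₂ a b c = cong (_+ c) (+-suc a b)

total-suc₃ : ∀ a b c → total (a , b , suc c) ≡ suc (total (a , b , c))
total-suc₃ a b c = +-suc (a + b) c

total-suc₂₃ : ∀ a b c → total (a , suc b , suc c) ≡ suc (suc (total (a , b , c)))
total-suc₂₃ a b c = trans (total-suc₃ a (suc b) c) (cong suc (total-suc₂ a b c))

InSlab : ℕ → Triple → Set
InSlab k t = total t ≡ k ⊎ suc (total t) ≡ k

InSlab⇒total≤ : ∀ k {t} → InSlab k t → total t ≤ k
InSlab⇒total≤ k (inj₁ eq) = ≤-reflexive eq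
InSlab⇒total≤ k (inj₂ eq) = ≤-trans (n≤1+n _) (≤-reflexive eq)

InSlab⇒total≥ : ∀ k {t} → InSlab (suc k) t → k ≤ total t
InSlab⇒total≥ k (inj₁ eq) = ≤-trans (n≤1+n k) (≤-reflexive (sym eq))
InSlab⇒total≥ k (inj₂ eq) = ≤-reflexive (sym (suc-injective eq))

-- Enumerates InSlab k: the triples with a > 0 come from slab k, those with a = 0 from two antidiagonals.
slab : ℕ → List Triple
slab zero    = (0 , 0 , 0) ∷ []
slab (suc k) = map (map₁ suc) (slab k) ++ map (0 ,_) (antidiagonal (suc k) ++ antidiagonal k)

∈-slab⁻ : ∀ k {t} → t ∈ slab k → InSlab k t
∈-slab⁻ zero    (here refl) = inj₁ refl
∈-slab⁻ (suc k) p with ∈-++⁻ (map (map₁ suc) (slab k)) p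
... | inj₁ q with ∈-map⁻ (map₁ suc) q
...   | _ , r , refl = ⊎-map (cong suc) (cong suc) (∈-slab⁻ k r)
∈-slab⁻ (suc k) p | inj₂ q with ∈-map⁻ (0 ,_) q
... | _ , r , refl with ∈-++⁻ (antidiagonal (suc k)) r
...   | inj₁ s = inj₁ (∈-antidiagonal⁻ (suc k) s)
...   | inj₂ s = inj₂ (cong suc (∈-antidiagonal⁻ k s))

∈-slab⁺ : ∀ k {a b c} → InSlab k (a , b , c) → (a , b , c) ∈ slab k
∈-slab⁺ zero    {zero}  {zero}  {zero}  (inj₁ _) = here refl
∈-slab⁺ zero    {zero}  {zero}  {suc _} (inj₁ ())
∈-slab⁺ zero    {zero}  {suc _}         (inj₁ ())
∈-slab⁺ zero    {suc _}                 (inj₁ ())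
∈-slab⁺ zero                            (inj₂ ())
∈-slab⁺ (suc k) {suc a} s =
  ∈-++⁺ˡ (∈-map⁺ (map₁ suc) (∈-slab⁺ k (⊎-map suc-injective suc-injective s)))
∈-slab⁺ (suc k) {zero} (inj₁ e) =
  ∈-++⁺ʳ _ (∈-map⁺ (0 ,_) (∈-++⁺ˡ (∈-antidiagonal⁺ e)))
∈-slab⁺ (suc k) {zero} (inj₂ e) =
  ∈-++⁺ʳ _ (∈-map⁺ (0 ,_) (∈-++⁺ʳ (antidiagonal (suc k)) (∈-antidiagonal⁺ (suc-injective e))))

slab-unique : ∀ k → Unique (slab k)
slab-unique zero    = All.[] ∷ []
slab-unique (suc k) =
  Unique.++⁺ (Unique.map⁺ map₁-suc-injective (slab-unique k))
             (Unique.map⁺ ,-injectiveʳ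
               (Unique.++⁺ (antidiagonal-unique (suc k)) (antidiagonal-unique k) layers-disjoint))
             head-disjoint
  where
  layers-disjoint : ∀ {p} → ¬ (p ∈ antidiagonal (suc k) × p ∈ antidiagonal k)
  layers-disjoint (p , q) = 1+n≢n (trans (sym (∈-antidiagonal⁻ (suc k) p)) (∈-antidiagonal⁻ k q))
  head-disjoint : ∀ {t} → ¬ (t ∈ map (map₁ suc) (slab k) × t ∈ map (0 ,_) _)
  head-disjoint (p , q) with ∈-map⁻ (map₁ suc) p | ∈-map⁻ (0 ,_) q
  ... | _ , _ , refl | _ , _ , ()

rotate : Triple → Triple
rotate (a , b , c) = (b , c , a)

rotate-injective : ∀ {s t} → rotate s ≡ rotate t → s ≡ t
rotate-injective {_ , _ , _} {_ , _ , _} refl = refl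

total-rotate : ∀ t → total (rotate t) ≡ total t
total-rotate (a , b , c) = rearrange a b c
  where
  rearrange : ∀ a b c → b + c + a ≡ a + b + c
  rearrange = solve-∀

slab-rotate : ∀ k → map rotate (slab k) ↭ slab k
slab-rotate k = ∼bag⇒↭ (unique∧set⇒bag (Unique.map⁺ rotate-injective (slab-unique k)) (slab-unique k)
  (mk⇔ to from))
  where
  preserved : ∀ s t → total s ≡ total t → InSlab k s → InSlab k t
  preserved s t eq = ⊎-map (trans (sym eq)) (trans (cong suc (sym eq)))
  to : ∀ {t} → t ∈ map rotate (slab k) → t ∈ slab k
  to p with ∈-map⁻ rotate p
  ... | s@(_ , _ , _) , q , refl = ∈-slab⁺ k (preserved s (rotate s) (sym (total-rotate s)) (∈-slab⁻ k q))
  from : ∀ {t} → t ∈ slab k → t ∈ map rotate (slab k)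
  from {a , b , c} p =
    ∈-map⁺ rotate (∈-slab⁺ k (preserved (a , b , c) (c , a , b) (total-rotate (c , a , b)) (∈-slab⁻ k p)))

-- The ℓ¹ metric on triples

L1 : Triple → Triple → ℕ
L1 (a , b , c) (a′ , b′ , c′) = ∣ a - a′ ∣ + ∣ b - b′ ∣ + ∣ c - c′ ∣

L1-sym : ∀ s t → L1 s t ≡ L1 t s
L1-sym (a , b , c) (a′ , b′ , c′) rewrite ∣-∣-comm a a′ | ∣-∣-comm b b′ | ∣-∣-comm c c′ = refl

L1-triangle : ∀ s t u → L1 s u ≤ L1 s t + L1 t u
L1-triangle (a , b , c) (a′ , b′ , c′) (a″ , b″ , c″) = begin
  ∣ a - a″ ∣ + ∣ b - b″ ∣ + ∣ c - c″ ∣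
    ≤⟨ +-mono-≤ (+-mono-≤ (∣-∣-triangle a a′ a″) (∣-∣-triangle b b′ b″)) (∣-∣-triangle c c′ c″) ⟩
  (∣ a - a′ ∣ + ∣ a′ - a″ ∣) + (∣ b - b′ ∣ + ∣ b′ - b″ ∣) + (∣ c - c′ ∣ + ∣ c′ - c″ ∣)
    ≡⟨ regroup ∣ a - a′ ∣ ∣ a′ - a″ ∣ ∣ b - b′ ∣ ∣ b′ - b″ ∣ ∣ c - c′ ∣ ∣ c′ - c″ ∣ ⟩
  (∣ a - a′ ∣ + ∣ b - b′ ∣ + ∣ c - c′ ∣) + (∣ a′ - a″ ∣ + ∣ b′ - b″ ∣ + ∣ c′ - c″ ∣) ∎
  where
  open ≤-Reasoning
  regroup : ∀ x x′ y y′ z z′ → (x + x′) + (y + y′) + (z + z′) ≡ (x + y + z) + (x′ + y′ + z′)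
  regroup = solve-∀

L1-self : ∀ t → L1 t t ≡ 0
L1-self (a , b , c) rewrite ∣n-n∣≡0 a | ∣n-n∣≡0 b | ∣n-n∣≡0 c = refl

L1≡0⇒≡ : ∀ {s t} → L1 s t ≡ 0 → s ≡ t
L1≡0⇒≡ {a , b , c} {a′ , b′ , c′} eq =
  cong₂ _,_ (∣m-n∣≡0⇒m≡n (m+n≡0⇒m≡0 _ ab≡0)) (cong₂ _,_ (∣m-n∣≡0⇒m≡n (m+n≡0⇒n≡0 _ ab≡0))
                                                         (∣m-n∣≡0⇒m≡n (m+n≡0⇒n≡0 _ eq)))
  where
  ab≡0 : ∣ a - a′ ∣ + ∣ b - b′ ∣ ≡ 0
  ab≡0 = m+n≡0⇒m≡0 _ eq

∣1+m-n∣≡1+∣m-n∣ : ∀ {m n} → n ≤ m → ∣ suc m - n ∣ ≡ suc ∣ m - n ∣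
∣1+m-n∣≡1+∣m-n∣ {m} z≤n   = cong suc (sym (∣-∣-identityʳ m))
∣1+m-n∣≡1+∣m-n∣ (s≤s n≤m) = ∣1+m-n∣≡1+∣m-n∣ n≤m

∣m-n∣≡1+∣1+m-n∣ : ∀ {m n} → m < n → ∣ m - n ∣ ≡ suc ∣ suc m - n ∣
∣m-n∣≡1+∣1+m-n∣ {zero}  (s≤s z≤n) = refl
∣m-n∣≡1+∣1+m-n∣ {suc m} (s≤s m<n) = ∣m-n∣≡1+∣1+m-n∣ m<n

module _ (a b c a′ b′ c′ : ℕ) where

  L1-suc₁-away : a′ ≤ a → L1 (suc a , b , c) (a′ , b′ , c′) ≡ suc (L1 (a , b , c) (a′ , b′ , c′))
  L1-suc₁-away a′≤a = cong (λ x → x + ∣ b - b′ ∣ + ∣ c - c′ ∣) (∣1+m-n∣≡1+∣m-n∣ a′≤a)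

  L1-suc₂-away : b′ ≤ b → L1 (a , suc b , c) (a′ , b′ , c′) ≡ suc (L1 (a , b , c) (a′ , b′ , c′))
  L1-suc₂-away b′≤b rewrite ∣1+m-n∣≡1+∣m-n∣ b′≤b = cong (_+ ∣ c - c′ ∣) (+-suc ∣ a - a′ ∣ ∣ b - b′ ∣)

  L1-suc₃-away : c′ ≤ c → L1 (a , b , suc c) (a′ , b′ , c′) ≡ suc (L1 (a , b , c) (a′ , b′ , c′))
  L1-suc₃-away c′≤c rewrite ∣1+m-n∣≡1+∣m-n∣ c′≤c = +-suc (∣ a - a′ ∣ + ∣ b - b′ ∣) ∣ c - c′ ∣

  L1-suc₁-towards : a < a′ → L1 (a , b , c) (a′ , b′ , c′) ≡ suc (L1 (suc a , b , c) (a′ , b′ , c′))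
  L1-suc₁-towards a<a′ = cong (λ x → x + ∣ b - b′ ∣ + ∣ c - c′ ∣) (∣m-n∣≡1+∣1+m-n∣ a<a′)

  L1-suc₂-towards : b < b′ → L1 (a , b , c) (a′ , b′ , c′) ≡ suc (L1 (a , suc b , c) (a′ , b′ , c′))
  L1-suc₂-towards b<b′ rewrite ∣m-n∣≡1+∣1+m-n∣ b<b′ = cong (_+ ∣ c - c′ ∣) (+-suc ∣ a - a′ ∣ ∣ suc b - b′ ∣)

  L1-suc₃-towards : c < c′ → L1 (a , b , c) (a′ , b′ , c′) ≡ suc (L1 (a , b , suc c) (a′ , b′ , c′))
  L1-suc₃-towards c<c′ rewrite ∣m-n∣≡1+∣1+m-n∣ c<c′ = +-suc (∣ a - a′ ∣ + ∣ b - b′ ∣) ∣ suc c - c′ ∣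

module _ (a b c : ℕ) where

  L1-suc₁ : L1 (suc a , b , c) (a , b , c) ≡ 1
  L1-suc₁ = trans (L1-suc₁-away a b c a b c ≤-refl) (cong suc (L1-self (a , b , c)))

  L1-suc₂ : L1 (a , suc b , c) (a , b , c) ≡ 1
  L1-suc₂ = trans (L1-suc₂-away a b c a b c ≤-refl) (cong suc (L1-self (a , b , c)))

  L1-suc₃ : L1 (a , b , suc c) (a , b , c) ≡ 1
  L1-suc₃ = trans (L1-suc₃-away a b c a b c ≤-refl) (cong suc (L1-self (a , b , c)))

pointwise-≤⇒≡ : ∀ {a b c a′ b′ c′} → a ≤ a′ → b ≤ b′ → c ≤ c′ →
  total (a′ , b′ , c′) ≤ total (a , b , c) → (a , b , c) ≡ (a′ , b′ , c′)
pointwise-≤⇒≡ a≤ b≤ c≤ total≤ with m≤n⇒m<n∨m≡n a≤ | m≤n⇒m<n∨m≡n b≤ | m≤n⇒m<n∨m≡n c≤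
... | inj₁ a< | _      | _      = ⊥-elim (<⇒≱ (+-mono-<-≤ (+-mono-<-≤ a< b≤) c≤) total≤)
... | inj₂ _  | inj₁ b< | _     = ⊥-elim (<⇒≱ (+-mono-<-≤ (+-mono-≤-< a≤ b<) c≤) total≤)
... | inj₂ _  | inj₂ _ | inj₁ c< = ⊥-elim (<⇒≱ (+-mono-≤-< (+-mono-≤ a≤ b≤) c<) total≤)
... | inj₂ refl | inj₂ refl | inj₂ refl = refl

map-const : (y : Y) (xs : List X) → map (λ _ → y) xs ≡ replicate (length xs) y
map-const y []       = refl
map-const y (x ∷ xs) = cong (y ∷_) (map-const y xs)

sum-replicate : ∀ r x → sum (replicate r x) ≡ r * x
sum-replicate zero    x = refl
sum-replicate (suc r) x = cong (_+_ x) (sum-replicate r x)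

pairSum-replicate-0 : ∀ r → pairSum ∣_-_∣ (replicate r 0) ≡ 0
pairSum-replicate-0 zero    = refl
pairSum-replicate-0 (suc r) =
  cong₂ _+_ (trans (cong sum (map-replicate (∣ 0 -_∣) r 0)) (trans (sum-replicate r 0) (*-zeroʳ r)))
            (pairSum-replicate-0 r)

crossSum-replicate-0 : ∀ xs r →
  crossSum ∣_-_∣ (map suc xs) (replicate r 0) ≡ r * (sum xs + length xs)
crossSum-replicate-0 []       r = sym (*-zeroʳ r)
crossSum-replicate-0 (x ∷ xs) r
  rewrite crossSum-replicate-0 xs r | map-replicate (∣ suc x -_∣) r 0 | sum-replicate r (suc x) =
  rearrange r x (sum xs) (length xs)
  where
  rearrange : ∀ r x s l → r * suc x + r * (s + l) ≡ r * (x + s + suc l)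
  rearrange = solve-∀

-- Shifting a list up by one and appending r zeros: distances inside the shifted part are
-- unchanged, and each of its entries x lies at distance x + 1 from each of the r zeros.
pairSum-∣-∣-shift : ∀ xs r →
  pairSum ∣_-_∣ (map suc xs ++ replicate r 0) ≡ pairSum ∣_-_∣ xs + r * (sum xs + length xs)
pairSum-∣-∣-shift xs r = begin
  pairSum ∣_-_∣ (map suc xs ++ replicate r 0)
    ≡⟨ pairSum-++ ∣_-_∣ (map suc xs) (replicate r 0) ⟩
  pairSum ∣_-_∣ (map suc xs) + pairSum ∣_-_∣ (replicate r 0) + crossSum ∣_-_∣ (map suc xs) (replicate r 0)
    ≡⟨ cong₂ _+_ (cong₂ _+_ (pairSum-map ∣_-_∣ suc xs) (pairSum-replicate-0 r)) (crossSum-replicate-0 xs r) ⟩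
  pairSum ∣_-_∣ xs + 0 + r * (sum xs + length xs)
    ≡⟨ cong (_+ r * (sum xs + length xs)) (+-identityʳ _) ⟩
  pairSum ∣_-_∣ xs + r * (sum xs + length xs) ∎
  where open ≡-Reasoning

firsts : ℕ → List ℕ
firsts k = map proj₁ (slab k)

firsts-suc : ∀ k → firsts (suc k) ≡ map suc (firsts k) ++ replicate (suc (suc k) + suc k) 0
firsts-suc k = begin
  map proj₁ (map (map₁ suc) (slab k) ++ map (0 ,_) layers)
    ≡⟨ map-++ proj₁ (map (map₁ suc) (slab k)) (map (0 ,_) layers) ⟩
  map proj₁ (map (map₁ suc) (slab k)) ++ map proj₁ (map (0 ,_) layers)
    ≡⟨ cong₂ _++_ (trans (sym (map-∘ (slab k))) (map-∘ (slab k)))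
                  (trans (sym (map-∘ layers)) (map-const 0 layers)) ⟩
  map suc (firsts k) ++ replicate (length layers) 0
    ≡⟨ cong (λ r → map suc (firsts k) ++ replicate r 0) length-layers ⟩
  map suc (firsts k) ++ replicate (suc (suc k) + suc k) 0 ∎
  where
  open ≡-Reasoning
  layers = antidiagonal (suc k) ++ antidiagonal k
  length-layers : length layers ≡ suc (suc k) + suc k
  length-layers = trans (length-++ (antidiagonal (suc k)))
                        (cong₂ _+_ (length-antidiagonal (suc k)) (length-antidiagonal k))

length-firsts : ∀ k → length (firsts k) ≡ (k + 1) * (k + 1)
length-firsts zero    = refl
length-firsts (suc k) rewrite firsts-suc k
  | length-++ (map suc (firsts k)) {replicate (suc (suc k) + suc k) 0}
  | length-map suc (firsts k) | length-replicate (suc (suc k) + suc k) {0} | length-firsts k =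
  solve (k ∷ [])

sum-map-suc : ∀ xs → sum (map suc xs) ≡ sum xs + length xs
sum-map-suc []       = refl
sum-map-suc (x ∷ xs) rewrite sum-map-suc xs =
  trans (cong suc (sym (+-assoc x (sum xs) (length xs)))) (sym (+-suc (x + sum xs) (length xs)))

sum-firsts-suc : ∀ k → sum (firsts (suc k)) ≡ sum (firsts k) + length (firsts k)
sum-firsts-suc k rewrite firsts-suc k
  | sum-++ (map suc (firsts k)) (replicate (suc (suc k) + suc k) 0)
  | sum-map-suc (firsts k) | sum-replicate (suc (suc k) + suc k) 0
  | *-zeroʳ (suc (suc k) + suc k) = +-identityʳ _

sum-firsts : ∀ k → 6 * sum (firsts k) ≡ k * (k + 1) * (2 * k + 1)
sum-firsts zero    = refl
sum-firsts (suc k) rewrite sum-firsts-suc k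
  | *-distribˡ-+ 6 (sum (firsts k)) (length (firsts k)) | sum-firsts k | length-firsts k =
  solve (k ∷ [])

pairSum-firsts : ∀ k → 30 * pairSum ∣_-_∣ (firsts k) ≡ k * (k + 1) * (k + 2) * (2 * k + 1) * (2 * k + 3)
pairSum-firsts zero    = refl
pairSum-firsts (suc k) rewrite firsts-suc k | pairSum-∣-∣-shift (firsts k) (suc (suc k) + suc k) = begin
  30 * (P + r * (S + L))                   ≡⟨ rearrange P r S L ⟩
  30 * P + 5 * r * (6 * S) + 30 * r * L
    ≡⟨ cong₂ _+_ (cong₂ (λ p s → p + 5 * r * s) (pairSum-firsts k) (sum-firsts k))
                 (cong (30 * r *_) (length-firsts k)) ⟩
  k * (k + 1) * (k + 2) * (2 * k + 1) * (2 * k + 3) + 5 * r * (k * (k + 1) * (2 * k + 1))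
    + 30 * r * ((k + 1) * (k + 1))         ≡⟨ closed-form-step k ⟩
  suc k * (suc k + 1) * (suc k + 2) * (2 * suc k + 1) * (2 * suc k + 3) ∎
  where
  open ≡-Reasoning
  P = pairSum ∣_-_∣ (firsts k)
  S = sum (firsts k)
  L = length (firsts k)
  r = suc (suc k) + suc k
  rearrange : ∀ P r S L → 30 * (P + r * (S + L)) ≡ 30 * P + 5 * r * (6 * S) + 30 * r * L
  rearrange = solve-∀
  closed-form-step : ∀ k → let r = suc (suc k) + suc k in
    k * (k + 1) * (k + 2) * (2 * k + 1) * (2 * k + 3) + 5 * r * (k * (k + 1) * (2 * k + 1))
      + 30 * r * ((k + 1) * (k + 1))
    ≡ suc k * (suc k + 1) * (suc k + 2) * (2 * suc k + 1) * (2 * suc k + 3)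
  closed-form-step = solve-∀

-- By the rotational symmetry of the slab, each coordinate contributes the same pair sum.
pairSum-L1-slab : ∀ k → pairSum L1 (slab k) ≡ 3 * pairSum ∣_-_∣ (firsts k)
pairSum-L1-slab k = begin
  pairSum L1 (slab k)
    ≡⟨ pairSum-+ (λ x y → d₁ x y + d₂ x y) d₃ (slab k) ⟩
  pairSum (λ x y → d₁ x y + d₂ x y) (slab k) + pairSum d₃ (slab k)
    ≡⟨ cong (_+ pairSum d₃ (slab k)) (pairSum-+ d₁ d₂ (slab k)) ⟩
  P₁ + pairSum d₂ (slab k) + pairSum d₃ (slab k)
    ≡⟨ cong₂ _+_ (cong (_+_ P₁) (rotation-invariant d₁ d₁-sym))
                 (trans (rotation-invariant d₂ (λ x y → d₁-sym (rotate x) (rotate y)))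
                        (rotation-invariant d₁ d₁-sym)) ⟩
  P₁ + P₁ + P₁
    ≡⟨ triple P₁ ⟩
  3 * P₁
    ≡⟨ cong (3 *_) (sym (pairSum-map ∣_-_∣ proj₁ (slab k))) ⟩
  3 * pairSum ∣_-_∣ (firsts k) ∎
  where
  open ≡-Reasoning
  d₁ d₂ d₃ : Triple → Triple → ℕ
  d₁ x y = ∣ proj₁ x - proj₁ y ∣
  d₂ x y = d₁ (rotate x) (rotate y)
  d₃ x y = d₂ (rotate x) (rotate y)
  P₁ = pairSum d₁ (slab k)
  d₁-sym : ∀ x y → d₁ x y ≡ d₁ y x
  d₁-sym x y = ∣-∣-comm (proj₁ x) (proj₁ y)
  rotation-invariant : ∀ d → (∀ x y → d x y ≡ d y x) →
    pairSum (λ x y → d (rotate x) (rotate y)) (slab k) ≡ pairSum d (slab k)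
  rotation-invariant d d-sym = trans (sym (pairSum-map d rotate (slab k))) (pairSum-↭ d d-sym (slab-rotate k))
  triple : ∀ p → p + p + p ≡ 3 * p
  triple = solve-∀

-- The point (b − c, 2a − b − c − 2n + 2) in the units of Defs; raising one coordinate moves by one
-- edge in one of the three edge directions of the honeycomb, namely by toPoint 1 of a unit vector.
toPoint : ℕ → Triple → Point
toPoint n (a , b , c) = (+ b ℤ.- + c , + (a + a + 2) ℤ.- + (b + c + n + n))

toPoint-translate : ∀ n x y z a b c →
  toPoint n (x + a , y + b , z + c) ≡ toPoint n (a , b , c) +ᵖ toPoint 1 (x , y , z)
toPoint-translate n x y z a b c = cong₂ _,_
  (shift₁ (+ x) (+ y) (+ z) (+ a) (+ b) (+ c))
  (shift₂ (+ x) (+ y) (+ z) (+ a) (+ b) (+ c) (+ n))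
  where
  shift₁ : ∀ x y z a b c → (y ℤ.+ b) ℤ.- (z ℤ.+ c) ≡ (b ℤ.- c) ℤ.+ (y ℤ.- z)
  shift₁ = ℤ-Ring.solve-∀
  shift₂ : ∀ x y z a b c n →
    ((x ℤ.+ a) ℤ.+ (x ℤ.+ a) ℤ.+ ℤ.+ 2) ℤ.- ((y ℤ.+ b) ℤ.+ (z ℤ.+ c) ℤ.+ n ℤ.+ n)
    ≡ (a ℤ.+ a ℤ.+ ℤ.+ 2 ℤ.- (b ℤ.+ c ℤ.+ n ℤ.+ n)) ℤ.+ (x ℤ.+ x ℤ.+ ℤ.+ 2 ℤ.- (y ℤ.+ z ℤ.+ ℤ.+ 1 ℤ.+ ℤ.+ 1))
  shift₂ = ℤ-Ring.solve-∀

centre-toPoint : ∀ {m} r j s → total (r , j , s) ≡ m → centre (j + s) j ≡ toPoint (suc m) (r , j , s)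
centre-toPoint r j s refl = cong₂ _,_ (horizontal (+ j) (+ s)) (vertical (+ r) (+ j) (+ s))
  where
  -- Stated in the shape the goal unfolds to: + (2 * j) is + j ℤ.+ (+ j ℤ.+ + 0), and so on.
  horizontal : ∀ j s → (j ℤ.+ (j ℤ.+ ℤ.0ℤ)) ℤ.- (j ℤ.+ s) ≡ j ℤ.- s
  horizontal = ℤ-Ring.solve-∀
  vertical : ∀ r j s →
    ℤ.- ((j ℤ.+ s) ℤ.+ ((j ℤ.+ s) ℤ.+ ((j ℤ.+ s) ℤ.+ ℤ.0ℤ)))
    ≡ (r ℤ.+ r ℤ.+ ℤ.+ 2) ℤ.- (j ℤ.+ s ℤ.+ (ℤ.+ 1 ℤ.+ (r ℤ.+ j ℤ.+ s)) ℤ.+ (ℤ.+ 1 ℤ.+ (r ℤ.+ j ℤ.+ s)))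
  vertical = ℤ-Ring.solve-∀

-- The corners of the hexagon centred at the point of t, in the order 90°, 30°, …, 150°.
corners : Triple → List Triple
corners (a , b , c) =
  (suc a , b , c) ∷ (suc a , suc b , c) ∷ (a , suc b , c) ∷
  (a , suc b , suc c) ∷ (a , b , suc c) ∷ (suc a , b , suc c) ∷ []

cycle : List X → List (X × X)
cycle []       = []
cycle (x ∷ xs) = zip (x ∷ xs) (xs ++ x ∷ [])

hexVertices-toPoint : ∀ n t → hexVertices (toPoint n t) ≡ map (toPoint n) (corners t)
hexVertices-toPoint n (a , b , c) = sym
  (cong₂ _∷_ (toPoint-translate n 1 0 0 a b c) (cong₂ _∷_ (toPoint-translate n 1 1 0 a b c)
  (cong₂ _∷_ (toPoint-translate n 0 1 0 a b c) (cong₂ _∷_ (toPoint-translate n 0 1 1 a b c)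
  (cong₂ _∷_ (toPoint-translate n 0 0 1 a b c) (cong₂ _∷_ (toPoint-translate n 1 0 1 a b c) refl))))))

hexEdges-toPoint : ∀ n t →
  hexEdges (toPoint n t) ≡ map (×-map (toPoint n) (toPoint n)) (cycle (corners t))
hexEdges-toPoint n t = cong cycle (hexVertices-toPoint n t)

-- Going around a hexagon raises and lowers the three coordinates in turn.
corner-edge : ∀ t {x y} → (x , y) ∈ cycle (corners t) → x ∈ corners t × y ∈ corners t × L1 x y ≡ 1
corner-edge (a , b , c) (here refl) =
  here refl , there (here refl) , trans (L1-sym (suc a , b , c) (suc a , suc b , c)) (L1-suc₂ (suc a) b c)
corner-edge (a , b , c) (there (here refl)) =
  there (here refl) , there (there (here refl)) , L1-suc₁ a (suc b) c
corner-edge (a , b , c) (there (there (here refl))) =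
  there (there (here refl)) , there (there (there (here refl))) ,
  trans (L1-sym (a , suc b , c) (a , suc b , suc c)) (L1-suc₃ a (suc b) c)
corner-edge (a , b , c) (there (there (there (here refl)))) =
  there (there (there (here refl))) , there (there (there (there (here refl)))) , L1-suc₂ a b (suc c)
corner-edge (a , b , c) (there (there (there (there (here refl))))) =
  there (there (there (there (here refl)))) , there (there (there (there (there (here refl))))) ,
  trans (L1-sym (a , b , suc c) (suc a , b , suc c)) (L1-suc₁ a b (suc c))
corner-edge (a , b , c) (there (there (there (there (there (here refl)))))) =
  there (there (there (there (there (here refl))))) , here refl , L1-suc₃ (suc a) b c

p-q≡r-s⇒p+s≡r+q : ∀ p q r s → + p ℤ.- + q ≡ + r ℤ.- + s → p + s ≡ r + q
p-q≡r-s⇒p+s≡r+q p q r s eq = ℤ.+-injective (begin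
  + p ℤ.+ + s                     ≡⟨ sym (cancel (+ p) (+ q) (+ s)) ⟩
  (+ p ℤ.- + q) ℤ.+ (+ q ℤ.+ + s) ≡⟨ cong (ℤ._+ (+ q ℤ.+ + s)) eq ⟩
  (+ r ℤ.- + s) ℤ.+ (+ q ℤ.+ + s) ≡⟨ cancel′ (+ r) (+ q) (+ s) ⟩
  + r ℤ.+ + q                     ∎)
  where
  open ≡-Reasoning
  cancel : ∀ x y z → (x ℤ.- y) ℤ.+ (y ℤ.+ z) ≡ x ℤ.+ z
  cancel = ℤ-Ring.solve-∀
  cancel′ : ∀ x y z → (x ℤ.- z) ℤ.+ (y ℤ.+ z) ≡ x ℤ.+ y
  cancel′ = ℤ-Ring.solve-∀

3*m≢1+3*n : ∀ m n → 3 * m ≢ suc (3 * n)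
3*m≢1+3*n zero    n       ()
3*m≢1+3*n (suc m) zero    eq rewrite *-suc 3 m with eq
... | ()
3*m≢1+3*n (suc m) (suc n) eq rewrite *-suc 3 m | *-suc 3 n =
  3*m≢1+3*n m n (suc-injective (suc-injective (suc-injective eq)))

sum-and-difference : ∀ {b c b′ c′} → b + c ≡ b′ + c′ → b + c′ ≡ b′ + c → b ≡ b′ × c ≡ c′
sum-and-difference {b} {c} {b′} {c′} sum diff =
  b≡b′ , +-cancelˡ-≡ b c c′ (trans sum (cong (_+ c′) (sym b≡b′)))
  where
  double : 2 * b + (c + c′) ≡ 2 * b′ + (c + c′)
  double = begin
    2 * b + (c + c′)   ≡⟨ regroup b c c′ ⟩
    (b + c) + (b + c′) ≡⟨ cong₂ _+_ sum diff ⟩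
    (b′ + c′) + (b′ + c) ≡⟨ trans (+-comm (b′ + c′) _) (sym (regroup b′ c c′)) ⟩
    2 * b′ + (c + c′)  ∎
    where
    open ≡-Reasoning
    regroup : ∀ b c c′ → 2 * b + (c + c′) ≡ (b + c) + (b + c′)
    regroup = solve-∀
  b≡b′ : b ≡ b′
  b≡b′ = *-cancelˡ-≡ b b′ 2 (+-cancelʳ-≡ (c + c′) (2 * b) (2 * b′) double)

-- Two triples with the same point have 3a − (a + b + c) = 3a′ − (a′ + b′ + c′) and b − c = b′ − c′;
-- as their totals differ by at most one, the first equation forces equal totals.
toPoint-injective : ∀ k n {s t} → InSlab k s → InSlab k t → toPoint n s ≡ toPoint n t → s ≡ t
toPoint-injective k n {a , b , c} {a′ , b′ , c′} s∈ t∈ eq = by-totals s∈ t∈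
  where
  difference : b + c′ ≡ b′ + c
  difference = p-q≡r-s⇒p+s≡r+q b c b′ c′ (cong proj₁ eq)
  height : a + a + 2 + (b′ + c′ + n + n) ≡ a′ + a′ + 2 + (b + c + n + n)
  height = p-q≡r-s⇒p+s≡r+q (a + a + 2) (b + c + n + n) (a′ + a′ + 2) (b′ + c′ + n + n) (cong proj₂ eq)
  key : 3 * a + total (a′ , b′ , c′) ≡ 3 * a′ + total (a , b , c)
  key = +-cancelʳ-≡ (2 + n + n) _ _ (begin
    3 * a + (a′ + b′ + c′) + (2 + n + n)     ≡⟨ regroupˡ a a′ b′ c′ n ⟩
    a + a + 2 + (b′ + c′ + n + n) + (a + a′) ≡⟨ cong (_+ (a + a′)) height ⟩
    a′ + a′ + 2 + (b + c + n + n) + (a + a′) ≡⟨ regroupʳ a a′ b c n ⟩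
    3 * a′ + (a + b + c) + (2 + n + n)       ∎)
    where
    open ≡-Reasoning
    regroupˡ : ∀ a a′ b′ c′ n → 3 * a + (a′ + b′ + c′) + (2 + n + n) ≡ a + a + 2 + (b′ + c′ + n + n) + (a + a′)
    regroupˡ = solve-∀
    regroupʳ : ∀ a a′ b c n → a′ + a′ + 2 + (b + c + n + n) + (a + a′) ≡ 3 * a′ + (a + b + c) + (2 + n + n)
    regroupʳ = solve-∀
  same-total : total (a , b , c) ≡ total (a′ , b′ , c′) → (a , b , c) ≡ (a′ , b′ , c′)
  same-total eq-total with *-cancelˡ-≡ a a′ 3 (+-cancelʳ-≡ _ (3 * a) (3 * a′)
                                 (trans (cong (_+_ (3 * a)) eq-total) key))
  ... | refl = cong (a ,_) (cong₂ _,_ (proj₁ b,c) (proj₂ b,c))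
    where
    b,c = sum-and-difference
            (+-cancelˡ-≡ a _ _ (trans (sym (+-assoc a b c)) (trans eq-total (+-assoc a b′ c′)))) difference
  off-by-one : ∀ {x x′ T T′} → 3 * x + T′ ≡ 3 * x′ + T → T ≡ suc T′ → ⊥
  off-by-one {x} {x′} {T′ = T′} eq′ refl =
    3*m≢1+3*n x x′ (+-cancelʳ-≡ T′ _ _ (trans eq′ (+-suc (3 * x′) T′)))
  by-totals : InSlab k (a , b , c) → InSlab k (a′ , b′ , c′) → (a , b , c) ≡ (a′ , b′ , c′)
  by-totals (inj₁ s≡k) (inj₁ t≡k) = same-total (trans s≡k (sym t≡k))
  by-totals (inj₂ s≡k) (inj₂ t≡k) = same-total (suc-injective (trans s≡k (sym t≡k)))
  by-totals (inj₁ s≡k) (inj₂ t≡k) = ⊥-elim (off-by-one {a} {a′} key (trans s≡k (sym t≡k)))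
  by-totals (inj₂ s≡k) (inj₁ t≡k) = ⊥-elim (off-by-one {a′} {a} (sym key) (trans t≡k (sym s≡k)))

-- The graph A (suc m) in triple coordinates

module _ (m : ℕ) where

  private
    n = suc m
    point = toPoint n
    points = ×-map point point
    _≟ᵖ_ = ≡-dec ℤ._≟_ ℤ._≟_

  ∈-centres⁺ : ∀ {t} → total t ≡ m → point t ∈ centres n
  ∈-centres⁺ {r , j , s} eq =
    subst (_∈ centres n) (centre-toPoint r j s eq)
      (∈-concatMap-intro (λ i → map (centre i) (upTo (suc i))) (∈-upTo⁺ (s≤s j+s≤m))
                         (∈-map⁺ (centre (j + s)) (∈-upTo⁺ (s≤s (m≤m+n j s)))))
    where
    j+s≤m : j + s ≤ m
    j+s≤m = subst (j + s ≤_) (trans (sym (+-assoc r j s)) eq) (m≤n+m (j + s) r)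

  ∈-centres⁻ : ∀ {c} → c ∈ centres n → Σ Triple λ t → total t ≡ m × c ≡ point t
  ∈-centres⁻ c∈ with ∈-concatMap-elim (λ i → map (centre i) (upTo (suc i))) (upTo n) c∈
  ... | i , i∈ , c∈row with ∈-map⁻ (centre i) c∈row
  ...   | j , j∈ , refl = (m ∸ i , j , i ∸ j) , total≡m ,
          trans (cong (λ i → centre i j) (sym j+[i∸j]≡i)) (centre-toPoint (m ∸ i) j (i ∸ j) total≡m)
    where
    j+[i∸j]≡i : j + (i ∸ j) ≡ i
    j+[i∸j]≡i = m+[n∸m]≡n (s≤s⁻¹ (∈-upTo⁻ j∈))
    total≡m : m ∸ i + j + (i ∸ j) ≡ m
    total≡m = trans (+-assoc (m ∸ i) j (i ∸ j))
             (trans (cong (_+_ (m ∸ i)) j+[i∸j]≡i) (m∸n+n≡m (s≤s⁻¹ (∈-upTo⁻ i∈))))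

  step-out : ∀ x y z {c a b d} → c ≡ point (a , b , d) →
    c +ᵖ toPoint 1 (x , y , z) ≡ point (x + a , y + b , z + d)
  step-out x y z {a = a} {b} {d} refl = sym (toPoint-translate n x y z a b d)

  pendants : List (Triple × Triple)
  pendants = ((n , 0 , 0) , (suc n , 0 , 0)) ∷ ((0 , 0 , n) , (0 , 0 , suc n))
           ∷ ((0 , n , 0) , (0 , suc n , 0)) ∷ []

  pendantEdges-toPoint : pendantEdges n ≡ map points pendants
  pendantEdges-toPoint =
    cong₂ _∷_ (pair 1 0 0 m 0 0 (centre-toPoint m 0 0 (trans (+-identityʳ (m + 0)) (+-identityʳ m))))
   (cong₂ _∷_ (pair 0 0 1 0 0 m (centre-toPoint 0 0 m refl))
   (cong₂ _∷_ (pair 0 1 0 0 m 0 (trans (cong (λ i → centre i m) (sym (+-identityʳ m)))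
                                  (centre-toPoint 0 m 0 (+-identityʳ m)))) refl))
    where
    pair : ∀ x y z a b d {c} → c ≡ point (a , b , d) →
      (c +ᵖ toPoint 1 (x , y , z) , (c +ᵖ toPoint 1 (x , y , z)) +ᵖ toPoint 1 (x , y , z))
        ≡ (point (x + a , y + b , z + d) , point (x + (x + a) , y + (y + b) , z + (z + d)))
    pair x y z a b d eq = cong₂ _,_ (step-out x y z eq) (step-out x y z (step-out x y z eq))

  corners-InSlab : ∀ {t x} → total t ≡ m → x ∈ corners t → InSlab (suc n) x
  corners-InSlab {a , b , c} refl (here refl) = inj₂ refl
  corners-InSlab {a , b , c} refl (there (here refl)) = inj₁ (cong suc (total-suc₂ a b c))
  corners-InSlab {a , b , c} refl (there (there (here refl))) = inj₂ (cong suc (total-suc₂ a b c))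
  corners-InSlab {a , b , c} refl (there (there (there (here refl)))) =
    inj₁ (total-suc₂₃ a b c)
  corners-InSlab {a , b , c} refl (there (there (there (there (here refl))))) =
    inj₂ (cong suc (total-suc₃ a b c))
  corners-InSlab {a , b , c} refl (there (there (there (there (there (here refl)))))) =
    inj₁ (cong suc (total-suc₃ a b c))

  Edge : Triple → Triple → Set
  Edge x y = (Σ Triple λ t → total t ≡ m × (x , y) ∈ cycle (corners t)) ⊎ (x , y) ∈ pendants

  Edge⇒∈edgesA : ∀ {x y} → Edge x y → (point x , point y) ∈ edgesA n
  Edge⇒∈edgesA {x} {y} (inj₁ (t , eq , xy∈)) =
    ∈-++⁺ˡ (∈-concatMap-intro hexEdges (∈-centres⁺ {t} eq)
      (subst ((point x , point y) ∈_) (sym (hexEdges-toPoint n t)) (∈-map⁺ points xy∈)))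
  Edge⇒∈edgesA {x} {y} (inj₂ xy∈) =
    ∈-++⁺ʳ (concatMap hexEdges (centres n))
      (subst ((point x , point y) ∈_) (sym pendantEdges-toPoint) (∈-map⁺ points xy∈))

  ∈edgesA⇒Edge : ∀ {u w} → (u , w) ∈ edgesA n →
    Σ Triple λ x → Σ Triple λ y → Edge x y × u ≡ point x × w ≡ point y
  ∈edgesA⇒Edge {u} {w} uw∈ with ∈-++⁻ (concatMap hexEdges (centres n)) uw∈
  ... | inj₁ uw∈hex with ∈-concatMap-elim hexEdges (centres n) uw∈hex
  ...   | c , c∈ , uw∈c with ∈-centres⁻ c∈
  ...     | t , eq , refl with ∈-map⁻ points (subst ((u , w) ∈_) (hexEdges-toPoint n t) uw∈c)
  ...       | (x , y) , xy∈ , uw≡ = x , y , inj₁ (t , eq , xy∈) , cong proj₁ uw≡ , cong proj₂ uw≡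
  ∈edgesA⇒Edge {u} {w} uw∈ | inj₂ uw∈pendant
    with ∈-map⁻ points (subst ((u , w) ∈_) pendantEdges-toPoint uw∈pendant)
  ... | (x , y) , xy∈ , uw≡ = x , y , inj₂ xy∈ , cong proj₁ uw≡ , cong proj₂ uw≡

  Edge-L1 : ∀ {x y} → Edge x y → L1 x y ≡ 1
  Edge-L1 (inj₁ (t , _ , xy∈)) = proj₂ (proj₂ (corner-edge t xy∈))
  Edge-L1 (inj₂ (here refl)) = trans (L1-sym (n , 0 , 0) (suc n , 0 , 0)) (L1-suc₁ n 0 0)
  Edge-L1 (inj₂ (there (here refl))) = trans (L1-sym (0 , 0 , n) (0 , 0 , suc n)) (L1-suc₃ 0 0 n)
  Edge-L1 (inj₂ (there (there (here refl)))) = trans (L1-sym (0 , n , 0) (0 , suc n , 0)) (L1-suc₂ 0 n 0)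

  Edge-InSlab : ∀ {x y} → Edge x y → InSlab (suc n) x × InSlab (suc n) y
  Edge-InSlab (inj₁ (t , eq , xy∈)) =
    corners-InSlab eq (proj₁ (corner-edge t xy∈)) , corners-InSlab eq (proj₁ (proj₂ (corner-edge t xy∈)))
  Edge-InSlab (inj₂ (here refl)) = inj₂ (cong suc n+0+0) , inj₁ (cong suc n+0+0)
    where n+0+0 = trans (+-identityʳ (n + 0)) (+-identityʳ n)
  Edge-InSlab (inj₂ (there (here refl))) = inj₂ refl , inj₁ refl
  Edge-InSlab (inj₂ (there (there (here refl)))) =
    inj₂ (cong suc (+-identityʳ n)) , inj₁ (+-identityʳ (suc n))

  corner-vertex : ∀ {t x} → total t ≡ m → x ∈ corners t → point x ∈ verticesA n
  corner-vertex {t} {x} eq x∈ =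
    ∈-deduplicate⁺ _≟ᵖ_ (∈-++⁺ˡ (∈-concatMap-intro hexVertices (∈-centres⁺ {t} eq)
      (subst (point x ∈_) (sym (hexVertices-toPoint n t)) (∈-map⁺ point x∈))))

  Edge-vertices : ∀ {x y} → Edge x y → point x ∈ verticesA n × point y ∈ verticesA n
  Edge-vertices (inj₁ (t , eq , xy∈)) =
    corner-vertex {t} eq (proj₁ (corner-edge t xy∈)) ,
    corner-vertex {t} eq (proj₁ (proj₂ (corner-edge t xy∈)))
  Edge-vertices {x} {y} (inj₂ xy∈) = attached xy∈ , pendant-vertex
    where
    attached : (x , y) ∈ pendants → point x ∈ verticesA n
    attached (here refl) =
      corner-vertex {m , 0 , 0} (trans (+-identityʳ (m + 0)) (+-identityʳ m)) (here refl)
    attached (there (here refl)) = corner-vertex {0 , 0 , m} refl (there (there (there (there (here refl)))))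
    attached (there (there (here refl))) =
      corner-vertex {0 , m , 0} (+-identityʳ m) (there (there (here refl)))
    pendant-vertex : point y ∈ verticesA n
    pendant-vertex = ∈-deduplicate⁺ _≟ᵖ_ (∈-++⁺ʳ (concatMap hexVertices (centres n))
      (∈-map⁺ proj₂ (subst ((point x , point y) ∈_) (sym pendantEdges-toPoint) (∈-map⁺ points xy∈))))

  ∈-verticesA⁻ : ∀ {u} → u ∈ verticesA n → Σ Triple λ t → InSlab (suc n) t × u ≡ point t
  ∈-verticesA⁻ {u} u∈ with ∈-++⁻ (concatMap hexVertices (centres n))
    (∈-deduplicate⁻ _≟ᵖ_ (concatMap hexVertices (centres n) ++ map proj₂ (pendantEdges n)) u∈)
  ... | inj₁ u∈hex with ∈-concatMap-elim hexVertices (centres n) u∈hex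
  ...   | c , c∈ , u∈c with ∈-centres⁻ c∈
  ...     | t , eq , refl with ∈-map⁻ point (subst (u ∈_) (hexVertices-toPoint n t) u∈c)
  ...       | x , x∈ , u≡ = x , corners-InSlab {t} eq x∈ , u≡
  ∈-verticesA⁻ {u} u∈ | inj₂ u∈pendant with ∈-map⁻ proj₂ u∈pendant
  ... | e , e∈ , refl with ∈-map⁻ points (subst (e ∈_) pendantEdges-toPoint e∈)
  ...   | (x , y) , xy∈ , e≡ = y , proj₂ (Edge-InSlab (inj₂ xy∈)) , cong proj₂ e≡

  Linked : Triple → Triple → Set
  Linked x y = Edge x y ⊎ Edge y x

  Linked⇒Adj : ∀ {x y} → Linked x y → Adj (A n) (point x) (point y)
  Linked⇒Adj = ⊎-map Edge⇒∈edgesA Edge⇒∈edgesA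

  Linked-vertices : ∀ {x y} → Linked x y → point x ∈ verticesA n × point y ∈ verticesA n
  Linked-vertices (inj₁ e) = Edge-vertices e
  Linked-vertices (inj₂ e) = swap (Edge-vertices e)

  private
    anchor : ∀ t → suc (suc (total t)) ≡ suc n → total t ≡ m
    anchor t eq = suc-injective (suc-injective eq)

    closer : ∀ {d d′ k} → d ≡ suc d′ → d ≡ suc k → d′ ≡ k
    closer e eq = suc-injective (trans (sym e) eq)

  lower₁ : ∀ a b c → total (suc a , b , c) ≡ suc n → Linked (suc a , b , c) (a , b , c)
  lower₁ a b (suc c) eq =
    inj₂ (inj₁ ((a , b , c) , anchor (a , b , c) (trans (cong suc (sym (total-suc₃ a b c))) eq) ,
                there (there (there (there (here refl))))))
  lower₁ a (suc b) zero eq =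
    inj₁ (inj₁ ((a , b , 0) , anchor (a , b , 0) (trans (cong suc (sym (total-suc₂ a b 0))) eq) ,
                there (here refl)))
  lower₁ a zero zero eq with trans (sym (trans (+-identityʳ (a + 0)) (+-identityʳ a))) (suc-injective eq)
  ... | refl = inj₂ (inj₂ (here refl))

  lower₂ : ∀ a b c → total (a , suc b , c) ≡ suc n → Linked (a , suc b , c) (a , b , c)
  lower₂ (suc a) b c eq =
    inj₂ (inj₁ ((a , b , c) , anchor (a , b , c) (trans (cong suc (sym (total-suc₂ a b c))) eq) , here refl))
  lower₂ zero b (suc c) eq =
    inj₁ (inj₁ ((0 , b , c) , anchor (0 , b , c) (trans (sym (total-suc₂₃ 0 b c)) eq) ,
                there (there (there (here refl)))))
  lower₂ zero b zero eq with trans (sym (+-identityʳ b)) (suc-injective eq)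
  ... | refl = inj₂ (inj₂ (there (there (here refl))))

  lower₃ : ∀ a b c → total (a , b , suc c) ≡ suc n → Linked (a , b , suc c) (a , b , c)
  lower₃ (suc a) b c eq =
    inj₁ (inj₁ ((a , b , c) , anchor (a , b , c) (trans (cong suc (sym (total-suc₃ a b c))) eq) ,
                there (there (there (there (there (here refl)))))))
  lower₃ zero (suc b) c eq =
    inj₂ (inj₁ ((0 , b , c) , anchor (0 , b , c) (trans (sym (total-suc₂₃ 0 b c)) eq) ,
                there (there (here refl))))
  lower₃ zero zero c eq with suc-injective eq
  ... | refl = inj₂ (inj₂ (there (here refl)))

  ∈-verticesA⁺ : ∀ {t} → InSlab (suc n) t → point t ∈ verticesA n
  ∈-verticesA⁺ {suc a , b , c}     (inj₁ eq) = proj₁ (Linked-vertices (lower₁ a b c eq))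
  ∈-verticesA⁺ {zero , suc b , c}  (inj₁ eq) = proj₁ (Linked-vertices (lower₂ 0 b c eq))
  ∈-verticesA⁺ {zero , zero , suc c} (inj₁ eq) = proj₁ (Linked-vertices (lower₃ 0 0 c eq))
  ∈-verticesA⁺ {a , b , c}         (inj₂ eq) = proj₂ (Linked-vertices (lower₁ a b c eq))

  decode : Point → Triple
  decode = invertOn _≟ᵖ_ point (0 , 0 , 0) (slab (suc n))

  decode-point : ∀ t → InSlab (suc n) t → decode (point t) ≡ t
  decode-point (a , b , c) t∈ =
    invertOn-correct _≟ᵖ_ point (0 , 0 , 0) (slab (suc n))
      (λ p q → toPoint-injective (suc n) n (∈-slab⁻ (suc n) p) (∈-slab⁻ (suc n) q)) (∈-slab⁺ (suc n) t∈)

  distance : Point → Point → ℕ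
  distance u v = L1 (decode u) (decode v)

  distance-point : ∀ s t → InSlab (suc n) s → InSlab (suc n) t → distance (point s) (point t) ≡ L1 s t
  distance-point s t s∈ t∈ = cong₂ L1 (decode-point s s∈) (decode-point t t∈)

  distance-edge : ∀ {u w} → (u , w) ∈ edgesA n → distance u w ≡ 1
  distance-edge uw∈ with ∈edgesA⇒Edge uw∈
  ... | x , y , e , refl , refl =
    trans (distance-point x y (proj₁ (Edge-InSlab {x} {y} e)) (proj₂ (Edge-InSlab {x} {y} e)))
          (Edge-L1 {x} {y} e)

  distance-Adj : ∀ {u w} → Adj (A n) u w → distance u w ≡ 1
  distance-Adj (inj₁ uw∈) = distance-edge uw∈
  distance-Adj {u} {w} (inj₂ wu∈) = trans (L1-sym (decode u) (decode w)) (distance-edge wu∈)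

  distance-≤-walk : ∀ {u v k} → Walk (A n) u v k → distance u v ≤ k
  distance-≤-walk {u} (here _) = ≤-reflexive (L1-self (decode u))
  distance-≤-walk {u} {v} (step {w = w} {k = k} adj walk) = begin
    distance u v                ≤⟨ L1-triangle (decode u) (decode w) (decode v) ⟩
    distance u w + distance w v ≤⟨ +-mono-≤ (≤-reflexive (distance-Adj adj)) (distance-≤-walk walk) ⟩
    suc k                       ∎
    where open ≤-Reasoning

  -- Greedy geodesic: from the upper layer lower a coordinate that exceeds the target's, from the
  -- lower layer raise one that falls short of it; if none exists the endpoints coincide.
  walk : ∀ k s t → InSlab (suc n) s → InSlab (suc n) t → L1 s t ≡ k → Walk (A n) (point s) (point t) k
  walk zero s t s∈ t∈ eq =
    subst (λ t → Walk (A n) (point s) (point t) 0) (L1≡0⇒≡ {s} {t} eq) (here (∈-verticesA⁺ {s} s∈))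
  walk (suc k) (a , b , c) t@(a′ , b′ , c′) (inj₁ upper) t∈ eq = descend a b c upper eq
    where
    descend : ∀ a b c → total (a , b , c) ≡ suc n → L1 (a , b , c) t ≡ suc k →
              Walk (A n) (point (a , b , c)) (point t) (suc k)
    descend a b c upper eq with a′ <? a | b′ <? b | c′ <? c
    descend (suc a) b c upper eq | yes (s≤s a′≤a) | _ | _ =
      step (Linked⇒Adj (lower₁ a b c upper))
           (walk k (a , b , c) t (inj₂ upper) t∈ (closer (L1-suc₁-away a b c a′ b′ c′ a′≤a) eq))
    descend a (suc b) c upper eq | no _ | yes (s≤s b′≤b) | _ =
      step (Linked⇒Adj (lower₂ a b c upper))
           (walk k (a , b , c) t (inj₂ (trans (sym (total-suc₂ a b c)) upper)) t∈
                 (closer (L1-suc₂-away a b c a′ b′ c′ b′≤b) eq))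
    descend a b (suc c) upper eq | no _ | no _ | yes (s≤s c′≤c) =
      step (Linked⇒Adj (lower₃ a b c upper))
           (walk k (a , b , c) t (inj₂ (trans (sym (total-suc₃ a b c)) upper)) t∈
                 (closer (L1-suc₃-away a b c a′ b′ c′ c′≤c) eq))
    descend a b c upper eq | no a≯ | no b≯ | no c≯
      with pointwise-≤⇒≡ (≮⇒≥ a≯) (≮⇒≥ b≯) (≮⇒≥ c≯)
             (≤-trans (InSlab⇒total≤ (suc n) {t} t∈) (≤-reflexive (sym upper)))
    ... | refl with trans (sym (L1-self t)) eq
    ...   | ()
  walk (suc k) (a , b , c) t@(a′ , b′ , c′) (inj₂ lower) t∈ eq = ascend a b c lower eq
    where
    ascend : ∀ a b c → suc (total (a , b , c)) ≡ suc n → L1 (a , b , c) t ≡ suc k →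
             Walk (A n) (point (a , b , c)) (point t) (suc k)
    ascend a b c lower eq with a <? a′ | b <? b′ | c <? c′
    ... | yes a<a′ | _ | _ =
      step (Linked⇒Adj (⊎-swap (lower₁ a b c lower)))
           (walk k (suc a , b , c) t (inj₁ lower) t∈ (closer (L1-suc₁-towards a b c a′ b′ c′ a<a′) eq))
    ... | no _ | yes b<b′ | _ =
      step (Linked⇒Adj (⊎-swap (lower₂ a b c (trans (total-suc₂ a b c) lower))))
           (walk k (a , suc b , c) t (inj₁ (trans (total-suc₂ a b c) lower)) t∈
                 (closer (L1-suc₂-towards a b c a′ b′ c′ b<b′) eq))
    ... | no _ | no _ | yes c<c′ =
      step (Linked⇒Adj (⊎-swap (lower₃ a b c (trans (total-suc₃ a b c) lower))))
           (walk k (a , b , suc c) t (inj₁ (trans (total-suc₃ a b c) lower)) t∈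
                 (closer (L1-suc₃-towards a b c a′ b′ c′ c<c′) eq))
    ... | no a≮ | no b≮ | no c≮
      with pointwise-≤⇒≡ (≮⇒≥ a≮) (≮⇒≥ b≮) (≮⇒≥ c≮)
             (≤-trans (≤-reflexive (suc-injective lower)) (InSlab⇒total≥ n {t} t∈))
    ... | refl with trans (sym (L1-self t)) eq
    ...   | ()

  distance-isDist : ∀ u v → u ∈ verticesA n → v ∈ verticesA n → IsDist (A n) u v (distance u v)
  distance-isDist u v u∈ v∈ with ∈-verticesA⁻ u∈ | ∈-verticesA⁻ v∈
  ... | s , s∈ , refl | t , t∈ , refl =
    subst (Walk (A n) (point s) (point t)) (sym (distance-point s t s∈ t∈)) (walk (L1 s t) s t s∈ t∈ refl) ,
    λ _ → distance-≤-walk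

  verticesA-↭ : verticesA n ↭ map point (slab (suc n))
  verticesA-↭ = ∼bag⇒↭ (unique∧set⇒bag
    (deduplicate-! _≟ᵖ_ (concatMap hexVertices (centres n) ++ map proj₂ (pendantEdges n)))
    (Unique-map-injectiveOn point (slab-unique (suc n)) injective)
    (mk⇔ to from))
    where
    injective : ∀ {s t} → s ∈ slab (suc n) → t ∈ slab (suc n) → point s ≡ point t → s ≡ t
    injective p q = toPoint-injective (suc n) n (∈-slab⁻ (suc n) p) (∈-slab⁻ (suc n) q)
    to : ∀ {u} → u ∈ verticesA n → u ∈ map point (slab (suc n))
    to u∈ with ∈-verticesA⁻ u∈
    ... | (a , b , c) , t∈ , refl = ∈-map⁺ point (∈-slab⁺ (suc n) {a} {b} {c} t∈)
    from : ∀ {u} → u ∈ map point (slab (suc n)) → u ∈ verticesA n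
    from u∈ with ∈-map⁻ point u∈
    ... | t , t∈ , refl = ∈-verticesA⁺ {t} (∈-slab⁻ (suc n) t∈)

  pairSum-distance : pairSum distance (verticesA n) ≡ 3 * pairSum ∣_-_∣ (firsts (suc n))
  pairSum-distance = begin
    pairSum distance (verticesA n)
      ≡⟨ pairSum-↭ distance (λ u v → L1-sym (decode u) (decode v)) verticesA-↭ ⟩
    pairSum distance (map point (slab (suc n)))
      ≡⟨ pairSum-map distance point (slab (suc n)) ⟩
    pairSum (λ s t → distance (point s) (point t)) (slab (suc n))
      ≡⟨ pairSum-cong _ L1 (slab (suc n)) (λ {s} {t} p q →
           distance-point s t (∈-slab⁻ (suc n) p) (∈-slab⁻ (suc n) q)) ⟩
    pairSum L1 (slab (suc n))
      ≡⟨ pairSum-L1-slab (suc n) ⟩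
    3 * pairSum ∣_-_∣ (firsts (suc n)) ∎
    where open ≡-Reasoning

wiener-polynomial : ∀ n →
  suc n * (suc n + 1) * (suc n + 2) * (2 * suc n + 1) * (2 * suc n + 3)
    ≡ 90 + 261 * n + 290 * n ^ 2 + 155 * n ^ 3 + 40 * n ^ 4 + 4 * n ^ 5
wiener-polynomial = solve-poly 1 (λ n →
    (con 1 :+ n) :* ((con 1 :+ n) :+ con 1) :* ((con 1 :+ n) :+ con 2)
      :* (con 2 :* (con 1 :+ n) :+ con 1) :* (con 2 :* (con 1 :+ n) :+ con 3)
  := con 90 :+ con 261 :* n :+ con 290 :* n :^ 2 :+ con 155 :* n :^ 3 :+ con 40 :* n :^ 4 :+ con 4 :* n :^ 5)
  refl
  where open Data.Nat.Solver.+-*-Solver using (_:+_; _:*_; _:^_; _:=_; con) renaming (solve to solve-poly)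

lemma1 : (n : ℕ) → 1 ≤ n →
    Σ ℕ λ w → IsWienerIndex (A n) w
      × 10 * w ≡ 90 + 261 * n + 290 * n ^ 2 + 155 * n ^ 3 + 40 * n ^ 4 + 4 * n ^ 5
lemma1 zero    ()
lemma1 (suc m) _ =
  pairSum (distance m) (verticesA (suc m)) ,
  (distance m , distance-isDist m , refl) ,
  (begin
    10 * pairSum (distance m) (verticesA (suc m)) ≡⟨ cong (10 *_) (pairSum-distance m) ⟩
    10 * (3 * P)                                  ≡⟨ sym (*-assoc 10 3 P) ⟩
    30 * P                                        ≡⟨ pairSum-firsts (suc (suc m)) ⟩
    _                                             ≡⟨ wiener-polynomial (suc m) ⟩
    _                                             ∎)
  where
  open ≡-Reasoning
  P = pairSum ∣_-_∣ (firsts (suc (suc m)))
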